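{- Let $T$ be a tree with root (start vertex) $v_s$ and non-negative vertex and edge weights, consider the no-return variant, and let $b_t$ be a leaf of $T$. An optimal traversal strategy among those that visit the leaf $b_t$ last can be obtained as follows. Let $C=T(b_{l_1},\dots,b_{l_m})$ be the collected subtree of $T$ containing $b_t$. (1) First, all collected subtrees of $T$ whose dominating edge weight is greater than that of $C$ are successively visited, fully explored (each, e.g., by depth-first search) and left, in decreasing order of the weights of their dominating edges. (2) Then the remaining collected subtrees not containing $b_t$ are visited (and fully explored) in an arbitrary order (e.g., by depth-first search). (3) Finally, $C$ is entered and the same procedure is applied recursively to $C$ with its root as start vertex: one forms the collected subtrees of $C$ with respect to its root, performs steps (1) and (2) for them, and recursively visits last (step (3)) the collected subtree of $C$ that contains $b_t$.
   Context: Strategic deployment problem: A tree $T=(V,E)$ has non-negative vertex weights $w_v$ and edge weights $w_e$ and start vertex $v_s$. Agents start at $v_s$ and all non-settled agents move as a single group along a walk starting at $v_s$; moving to a subtree means walking along the tree path from the current position, filling unfilled vertices on the way. When a vertex $v$ is reached for the first time, $w_v$ of the agents present must be left there permanently (settled); an edge $e$ may only be traversed if the group has at least $w_e$ agents. A strategy is valid if all vertices get filled; in the no-return variant nothing has to return to $v_s$. Optimal means minimum number of agents (here among valid strategies whose last filled vertex is $b_t$). Collected subtrees of a tree rooted at $r$: for each leaf $b$, let $e(b)$ be the edge of maximal weight on the path from $r$ to $b$, choosing among edges of equal maximal weight the one closest to $r$; $e(b)$ dominates $b$; let $v(b)$ be the endpoint of $e(b)$ farther from $r$, and $T_b$ the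 path from $v(b)$ to $b$. For leaves $b_{l_1},\dots,b_{l_m}$ dominated by the same edge $e$, the union of the paths $T_{b_{l_1}},\dots,T_{b_{l_m}}$ is the collected subtree $T(b_{l_1},\dots,b_{l_m})$, with root $v(b_{l_1})$ and dominating edge $e$; its dominating edge weight is $w_e$. -}

module Defs where

open import Data.Nat using (ℕ; zero; suc; _+_; _∸_; _≤_; _<_)
open import Data.Nat.Properties using (_≟_)
open import Data.List using (List; []; _∷_; _++_; [_]; map; upTo; take; length; reverse)
open import Data.List.Membership.Propositional using (_∈_; _∉_)
open import Data.List.Relation.Unary.All using (All)
open import Data.List.Relation.Unary.Unique.Propositional using (Unique)
open import Data.List.Relation.Unary.Linked using (Linked)
open import Data.Product using (Σ; ∃; _×_; _,_)
open import Data.Maybe using (Maybe; just; nothing)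
open import Relation.Binary.PropositionalEquality using (_≡_; _≢_)
open import Relation.Nullary using (yes; no)
open import Function.Bundles using (_⇔_)

-- A tree is a node carrying its vertex weight w_v and the list of its
-- children, each paired with the weight w_e of the edge to that child.
-- The root of the tree is the start vertex v_s.

data Tree : Set where
  node : ℕ → List (ℕ × Tree) → Tree

-- Vertices are addressed by the list of child indices from the root
-- (the root is the address []).
Addr : Set
Addr = List ℕ

subtreeAt   : Tree → Addr → Maybe Tree
subtreeAtCh : List (ℕ × Tree) → ℕ → Addr → Maybe Tree
subtreeAt t [] = just t
subtreeAt (node _ cs) (i ∷ a) = subtreeAtCh cs i a
subtreeAtCh [] _ _ = nothing
subtreeAtCh ((_ , c) ∷ _) zero a = subtreeAt c a
subtreeAtCh (_ ∷ cs) (suc i) a = subtreeAtCh cs i a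

IsVertex : Tree → Addr → Set
IsVertex t a = ∃ λ s → subtreeAt t a ≡ just s

IsLeaf : Tree → Addr → Set
IsLeaf t a = ∃ λ w → subtreeAt t a ≡ just (node w [])

-- vertex weight w_v (0 on non-addresses, never used there)
vw : Tree → Addr → ℕ
vw t a with subtreeAt t a
... | just (node w _) = w
... | nothing = 0

-- weight of the edge from the parent of a to a (0 for the root / non-addresses)
edgeInto   : Tree → Addr → ℕ
edgeIntoCh : List (ℕ × Tree) → ℕ → Addr → ℕ
edgeInto _ [] = 0
edgeInto (node _ cs) (i ∷ a) = edgeIntoCh cs i a
edgeIntoCh [] _ _ = 0
edgeIntoCh ((we , _) ∷ _) zero [] = we
edgeIntoCh ((_ , c) ∷ _) zero (j ∷ a) = edgeInto c (j ∷ a)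
edgeIntoCh (_ ∷ cs) (suc i) a = edgeIntoCh cs i a

_≼_ : Addr → Addr → Set
x ≼ y = ∃ λ s → x ++ s ≡ y

_≺_ : Addr → Addr → Set
x ≺ y = x ≼ y × x ≢ y

data Step (t : Tree) : Addr → Addr → ℕ → Set where
  down : ∀ {x y} (i : ℕ) → y ≡ x ++ [ i ] → IsVertex t y → Step t x y (edgeInto t y)
  up   : ∀ {x y} (i : ℕ) → x ≡ y ++ [ i ] → IsVertex t x → Step t x y (edgeInto t x)

-- Run t k vis cur W fin : the group currently has k agents, the filled
-- vertices so far are vis (most recently filled first), the group stands
-- at cur; following the walk W (the vertices entered, in order) is
-- possible, and the final list of filled vertices is fin.
data Run (t : Tree) : ℕ → List Addr → Addr → List Addr → List Addr → Set where
  stop    : ∀ {k vis cur} → Run t k vis cur [] vis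
  moveOld : ∀ {k vis cur y we W fin} →
            Step t cur y we → we ≤ k → y ∈ vis →
            Run t k vis y W fin → Run t k vis cur (y ∷ W) fin
  moveNew : ∀ {k vis cur y we W fin} →
            Step t cur y we → we ≤ k → y ∉ vis → vw t y ≤ k →
            Run t (k ∸ vw t y) (y ∷ vis) y W fin → Run t k vis cur (y ∷ W) fin

-- The walk W (starting at v_s) is a valid strategy for k agents whose
-- last filled vertex is bt.
Solves : Tree → Addr → ℕ → List Addr → Set
Solves t bt k W =
  Σ (List Addr) λ fin →
    vw t [] ≤ k ×
    Run t (k ∸ vw t []) ([] ∷ []) [] W fin ×
    (∀ v → IsVertex t v → v ∈ fin) ×
    (∃ λ rest → fin ≡ bt ∷ rest)

-- Dom t r b v : the dominating edge e(b) of the leaf b w.r.t. the root r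
-- is the edge into v (v is the endpoint of e(b) farther from r): it has
-- maximal weight on the path from r to b, and is the closest to r among
-- the edges of maximal weight.
Dom : Tree → Addr → Addr → Addr → Set
Dom t r b v =
  r ≺ v × v ≼ b ×
  (∀ w → r ≺ w → w ≺ v → edgeInto t w < edgeInto t v) ×
  (∀ w → v ≺ w → w ≼ b → edgeInto t w ≤ edgeInto t v)

IsCRoot : Tree → Addr → (Addr → Set) → Addr → Set
IsCRoot t r L v = Σ Addr λ b → L b × Dom t r b v

Group : Tree → Addr → (Addr → Set) → Addr → Addr → Set
Group t r L v b = L b × Dom t r b v

InC : Tree → Addr → (Addr → Set) → Addr → Addr → Set
InC t r L v x = Σ Addr λ b → Group t r L v b × v ≼ x × x ≼ b

data WalkFrom (t : Tree) : Addr → List Addr → Set where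
  []  : ∀ {x} → WalkFrom t x []
  _∷_ : ∀ {x y we ys} → Step t x y we → WalkFrom t y ys → WalkFrom t x (y ∷ ys)

endpoint : Addr → List Addr → Addr
endpoint x [] = x
endpoint _ (y ∷ ys) = endpoint y ys

Explore : Tree → Addr → (Addr → Set) → Addr → List Addr → Set
Explore t r L v E =
  WalkFrom t v E ×
  All (InC t r L v) E ×
  (∀ x → InC t r L v x → x ∈ v ∷ E) ×
  endpoint v E ≡ v

-- the tree path from a to b (vertices entered, excluding a)
commonPrefix : Addr → Addr → Addr
commonPrefix (x ∷ xs) (y ∷ ys) with x ≟ y
... | yes _ = x ∷ commonPrefix xs ys
... | no _ = []
commonPrefix _ _ = []

range : ℕ → ℕ → List ℕ
range i j = map (i +_) (upTo (j ∸ i))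

treePath : Addr → Addr → List Addr
treePath a b =
  reverse (map (λ k → take k a) (range m (length a))) ++
  map (λ k → take k b) (range (suc m) (suc (length b)))
  where m = length (commonPrefix a b)

-- Visits t r L cur vs W end : starting at cur, visit the collected
-- subtrees with roots vs in this order (walking along the tree path to the
-- root, then exploring fully); the walk is W and it ends at end.
data Visits (t : Tree) (r : Addr) (L : Addr → Set) : Addr → List Addr → List Addr → Addr → Set where
  []  : ∀ {cur} → Visits t r L cur [] [] cur
  _∷_ : ∀ {cur v vs E W end} →
        Explore t r L v E → Visits t r L v vs W end →
        Visits t r L cur (v ∷ vs) (treePath cur v ++ E ++ W) end

-- hi ++ lo is an admissible order of the collected subtrees other than the
-- one (rooted at vC) containing bt: first (hi) all with dominating edge
-- weight greater than that of C, in decreasing (non-increasing) order,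
-- then (lo) all remaining ones, in arbitrary order; each exactly once.
OrderSpec : Tree → Addr → (Addr → Set) → Addr → List Addr → List Addr → Set
OrderSpec t r L vC hi lo =
  Unique hi × Unique lo ×
  (∀ v → (v ∈ hi) ⇔ (IsCRoot t r L v × edgeInto t vC < edgeInto t v)) ×
  (∀ v → (v ∈ lo) ⇔ (IsCRoot t r L v × v ≢ vC × edgeInto t v ≤ edgeInto t vC)) ×
  Linked (λ x y → edgeInto t y ≤ edgeInto t x) hi

data Proc (t : Tree) (bt : Addr) : Addr → (Addr → Set) → List Addr → Set₁ where
  finished : ∀ {L} → Proc t bt bt L []
  level    : ∀ {r L vC hi lo W end W'} →
             Dom t r bt vC →
             OrderSpec t r L vC hi lo →
             Visits t r L r (hi ++ lo) W end →
             Proc t bt vC (Group t r L vC) W' →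
             Proc t bt r L (W ++ treePath end vC ++ W')

-- For a threshold c call a vertex c-heavy when the tree path
-- between it and bt contains an edge of weight at least c.  Traced backwards
-- from its end at bt, a strategy starts inside the region around bt reachable
-- over lighter edges and leaves it by crossing an edge of weight at least c.
-- Every c-heavy vertex lies outside that region, so it was filled before that
-- crossing; hence so were all its ancestors, and at the crossing the group
-- still had c agents besides the weight of this prefix-closed set.
--
-- Whenever the walk of the procedure crosses an edge of weight c,
-- every vertex filled so far lies above a c-heavy vertex: the subtrees explored
-- before hang off the path to bt below edges at least as heavy as the current
-- one.  So at each step the agents it needs are matched by the lower bound.

module Submission where

open import Defs
open import Data.Nat using (ℕ; zero; suc; _+_; _∸_; _≤_; _<_; z≤n; s≤s; _⊔_)
open import Data.Nat.Properties as ℕ using (≤-refl; ≤-trans; ≤-reflexive)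
open import Data.List using (List; []; _∷_; _++_; [_]; _∷ʳ_; length; take; drop; reverse; map; applyUpTo; applyDownFrom)
open import Data.List.Properties as List using (++-assoc; ++-identityʳ; ∷-injective; length-++)
open import Data.Product using (Σ; ∃; _×_; _,_; proj₁; proj₂)
open import Data.Sum as ⊎ using (_⊎_; inj₁; inj₂; [_,_]′)
open import Data.Empty using (⊥-elim)
open import Data.Maybe using (just)
open import Relation.Binary using (DecidableEquality; Decidable)
open import Relation.Binary.PropositionalEquality hiding ([_])
open import Relation.Nullary using (¬_; yes; no)
open import Function using (_∘_)
open import Function.Bundles using (Equivalence)
open import Data.List.Relation.Unary.Linked using (Linked; [-]; _∷_)
open import Data.List.Reverse using (Reverse; []; _∶_∶ʳ_; reverseView)
open import Data.List.Membership.Propositional using (_∈_; _∉_)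
open import Data.List.Membership.Propositional.Properties using (∈-++⁺ˡ; ∈-++⁺ʳ; ∈-++⁻; ∈-∃++)
open import Data.List.Relation.Unary.Any using (here; there)
open import Data.List.Relation.Unary.All as All using (All; []; _∷_)
open import Data.List.Relation.Unary.AllPairs using ([]; _∷_)
open import Data.List.Relation.Unary.Unique.Propositional using (Unique)
import Data.List.Relation.Unary.All.Properties as Allₚ
open import Algebra.Properties.CommutativeSemigroup ℕ.+-commutativeSemigroup using (x∙yz≈y∙xz)

_≟A_ : DecidableEquality Addr
_≟A_ = List.≡-dec ℕ._≟_

≼-refl : ∀ {x} → x ≼ x
≼-refl {x} = [] , ++-identityʳ x

≼-trans : ∀ {x y z} → x ≼ y → y ≼ z → x ≼ z
≼-trans {x} (s , refl) (s' , refl) = s ++ s' , sym (++-assoc x s s')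

[]≼ : ∀ {x} → [] ≼ x
[]≼ {x} = x , refl

≼-++ : ∀ {x} s → x ≼ (x ++ s)
≼-++ s = s , refl

≼-head : ∀ {a b x y} → (a ∷ x) ≼ (b ∷ y) → a ≡ b
≼-head (_ , p) = proj₁ (∷-injective p)

≼-tail : ∀ {a b x y} → (a ∷ x) ≼ (b ∷ y) → x ≼ y
≼-tail (s , p) = s , proj₂ (∷-injective p)

≼-cons : ∀ {a x y} → x ≼ y → (a ∷ x) ≼ (a ∷ y)
≼-cons (s , p) = s , cong (_ ∷_) p

≼-[] : ∀ {x} → x ≼ [] → x ≡ []
≼-[] {[]} _ = refl
≼-[] {_ ∷ _} (_ , ())

≼-length : ∀ {x y} → x ≼ y → length x ≤ length y
≼-length {x} (s , refl) = subst (length x ≤_) (sym (length-++ x)) (ℕ.m≤m+n (length x) (length s))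

_≼?_ : Decidable _≼_
[] ≼? y = yes []≼
(a ∷ x) ≼? [] = no λ { (_ , ()) }
(a ∷ x) ≼? (b ∷ y) with a ℕ.≟ b | x ≼? y
... | no a≢b  | _     = no λ p → a≢b (≼-head p)
... | yes _   | no ¬p = no λ p → ¬p (≼-tail p)
... | yes refl | yes p = yes (≼-cons p)

≼-antisym : ∀ {x y} → x ≼ y → y ≼ x → x ≡ y
≼-antisym {[]} {[]} _ _ = refl
≼-antisym {[]} {_ ∷ _} _ (_ , ())
≼-antisym {_ ∷ _} {[]} (_ , ()) _
≼-antisym {a ∷ x} {b ∷ y} p q with ≼-head p
... | refl = cong (a ∷_) (≼-antisym (≼-tail p) (≼-tail q))

≼-comparable : ∀ {x y z} → x ≼ z → y ≼ z → x ≼ y ⊎ y ≼ x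
≼-comparable {[]} _ _ = inj₁ []≼
≼-comparable {_ ∷ _} {[]} _ _ = inj₂ []≼
≼-comparable {_ ∷ _} {_ ∷ _} {[]} (_ , ()) _
≼-comparable {a ∷ x} {b ∷ y} {c ∷ z} p q with ≼-head p | ≼-head q | ≼-comparable (≼-tail p) (≼-tail q)
... | refl | refl | inj₁ r = inj₁ (≼-cons r)
... | refl | refl | inj₂ r = inj₂ (≼-cons r)

≼-∷ʳ⁻ : ∀ {z x i} → z ≼ (x ∷ʳ i) → z ≼ x ⊎ z ≡ x ∷ʳ i
≼-∷ʳ⁻ {[]} _ = inj₁ []≼
≼-∷ʳ⁻ {a ∷ []} {[]} (_ , p) with ∷-injective p
... | refl , _ = inj₂ refl
≼-∷ʳ⁻ {a ∷ _ ∷ _} {[]} (_ , p) with ∷-injective p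
... | _ , ()
≼-∷ʳ⁻ {a ∷ z} {b ∷ x} p with ≼-head p | ≼-∷ʳ⁻ {z} {x} (≼-tail p)
... | refl | inj₁ r = inj₁ (≼-cons r)
... | refl | inj₂ r = inj₂ (cong (a ∷_) r)

≺-≼-trans : ∀ {x y z} → x ≺ y → y ≼ z → x ≺ z
≺-≼-trans (p , q) r = ≼-trans p r , λ { refl → q (≼-antisym p r) }

≼-≺-trans : ∀ {x y z} → x ≼ y → y ≺ z → x ≺ z
≼-≺-trans p (q , r) = ≼-trans p q , λ { refl → r (≼-antisym q p) }

≺⇒⋡ : ∀ {x y} → x ≺ y → ¬ y ≼ x
≺⇒⋡ (p , q) r = q (≼-antisym p r)

≺-∷ʳ : ∀ {x i} → x ≺ (x ∷ʳ i)
≺-∷ʳ {x} = ≼-++ _ , λ e → ℕ.<-irrefl (cong length e) (≼-length-< x)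
  where
  ≼-length-< : ∀ x → length x < length (x ∷ʳ _)
  ≼-length-< x = subst (length x <_) (sym (length-++ x)) (ℕ.m<m+n (length x) (s≤s z≤n))

≺-∷ʳ⁻ : ∀ {z x i} → z ≺ (x ∷ʳ i) → z ≼ x
≺-∷ʳ⁻ (p , q) with ≼-∷ʳ⁻ p
... | inj₁ r = r
... | inj₂ r = ⊥-elim (q r)

take-≼ : ∀ k (a : Addr) → take k a ≼ a
take-≼ k a = drop k a , List.take++drop≡id k a

take-mono : ∀ {m k} (a : Addr) → m ≤ k → take m a ≼ take k a
take-mono {zero} a _ = []≼
take-mono {suc m} {suc k} [] _ = ≼-refl
take-mono {suc m} {suc k} (x ∷ a) (s≤s p) = ≼-cons (take-mono a p)

take-suc-∷ʳ : ∀ k (a : Addr) → suc k ≤ length a → ∃ λ i → take (suc k) a ≡ take k a ∷ʳ i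
take-suc-∷ʳ zero (x ∷ a) _ = x , refl
take-suc-∷ʳ (suc k) (x ∷ a) (s≤s p) with take-suc-∷ʳ k a p
... | i , e = i , cong (x ∷_) e

take-length-≼ : ∀ {x y : Addr} → x ≼ y → take (length x) y ≡ x
take-length-≼ {[]} _ = refl
take-length-≼ {a ∷ x} {[]} (_ , ())
take-length-≼ {a ∷ x} {b ∷ y} p with ≼-head p
... | refl = cong (a ∷_) (take-length-≼ (≼-tail p))

commonPrefix-≼ˡ : ∀ (a b : Addr) → commonPrefix a b ≼ a
commonPrefix-≼ˡ [] b = []≼
commonPrefix-≼ˡ (x ∷ a) [] = []≼
commonPrefix-≼ˡ (x ∷ a) (y ∷ b) with x ℕ.≟ y
... | yes _ = ≼-cons (commonPrefix-≼ˡ a b)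
... | no _ = []≼

commonPrefix-≼ʳ : ∀ (a b : Addr) → commonPrefix a b ≼ b
commonPrefix-≼ʳ [] b = []≼
commonPrefix-≼ʳ (x ∷ a) [] = []≼
commonPrefix-≼ʳ (x ∷ a) (y ∷ b) with x ℕ.≟ y
... | yes refl = ≼-cons (commonPrefix-≼ʳ a b)
... | no _ = []≼

commonPrefix-greatest : ∀ {z} (a b : Addr) → z ≼ a → z ≼ b → z ≼ commonPrefix a b
commonPrefix-greatest {[]} a b _ _ = []≼
commonPrefix-greatest {c ∷ z} [] b (_ , ()) _
commonPrefix-greatest {c ∷ z} (x ∷ a) [] _ (_ , ())
commonPrefix-greatest {c ∷ z} (x ∷ a) (y ∷ b) p q with x ℕ.≟ y | ≼-head p | ≼-head q
... | yes refl | refl | _ = ≼-cons (commonPrefix-greatest a b (≼-tail p) (≼-tail q))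
... | no x≢y | refl | refl = ⊥-elim (x≢y refl)

subtreeAt-++ : ∀ (t : Tree) a s {u} → subtreeAt t a ≡ just u → subtreeAt t (a ++ s) ≡ subtreeAt u s
subtreeAtCh-++ : ∀ cs i a s {u} → subtreeAtCh cs i a ≡ just u → subtreeAtCh cs i (a ++ s) ≡ subtreeAt u s
subtreeAt-++ t [] s refl = refl
subtreeAt-++ (node _ cs) (i ∷ a) s e = subtreeAtCh-++ cs i a s e
subtreeAtCh-++ [] i a s ()
subtreeAtCh-++ ((_ , c) ∷ cs) zero a s e = subtreeAt-++ c a s e
subtreeAtCh-++ (_ ∷ cs) (suc i) a s e = subtreeAtCh-++ cs i a s e

IsVertex-++⁻ : ∀ (t : Tree) a s → IsVertex t (a ++ s) → IsVertex t a
IsVertexCh-++⁻ : ∀ cs i a s {u} → subtreeAtCh cs i (a ++ s) ≡ just u → ∃ λ u' → subtreeAtCh cs i a ≡ just u'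
IsVertex-++⁻ t [] s _ = t , refl
IsVertex-++⁻ (node _ cs) (i ∷ a) s (_ , e) = IsVertexCh-++⁻ cs i a s e
IsVertexCh-++⁻ [] i a s ()
IsVertexCh-++⁻ ((_ , c) ∷ cs) zero a s e = IsVertex-++⁻ c a s (_ , e)
IsVertexCh-++⁻ (_ ∷ cs) (suc i) a s e = IsVertexCh-++⁻ cs i a s e

IsVertex-≼ : ∀ {t x y} → x ≼ y → IsVertex t y → IsVertex t x
IsVertex-≼ {t} {x} (s , refl) = IsVertex-++⁻ t x s

IsLeaf⇒IsVertex : ∀ {t b} → IsLeaf t b → IsVertex t b
IsLeaf⇒IsVertex (_ , e) = _ , e

leaf-maximal : ∀ {t b x} → IsLeaf t b → b ≼ x → IsVertex t x → x ≡ b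
leaf-maximal {t} {b} _ ([] , refl) _ = ++-identityʳ b
leaf-maximal {t} {b} (_ , e) (i ∷ s , refl) (_ , e') with trans (sym (subtreeAt-++ t b (i ∷ s) e)) e'
... | ()

leaf-below : ∀ {t x} → IsVertex t x → ∃ λ b → IsLeaf t b × x ≼ b
leaf-below {t} {x} (s , e) = go s x e
  where
  go : ∀ s x → subtreeAt t x ≡ just s → ∃ λ b → IsLeaf t b × x ≼ b
  go (node w []) x e = x , (w , e) , ≼-refl
  go (node w ((_ , c) ∷ _)) x e with go c (x ∷ʳ 0) (subtreeAt-++ t x [ 0 ] e)
  ... | b , lb , x0≼b = b , lb , ≼-trans (≼-++ [ 0 ]) x0≼b

data StepView (t : Tree) (x y : Addr) : ℕ → Set where
  down : ∀ i → y ≡ x ∷ʳ i → StepView t x y (edgeInto t y)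
  up   : ∀ i → x ≡ y ∷ʳ i → StepView t x y (edgeInto t x)

stepView : ∀ {t x y we} → Step t x y we → StepView t x y we
stepView (down i e _) = down i e
stepView (up i e _) = up i e

Step⇒IsVertex : ∀ {t x y we} → Step t x y we → IsVertex t y
Step⇒IsVertex (down _ _ v) = v
Step⇒IsVertex {t} {y = y} (up i refl v) = IsVertex-≼ {t} {y} (≼-++ [ i ]) v

endpoint-++ : ∀ s xs ys → endpoint s (xs ++ ys) ≡ endpoint (endpoint s xs) ys
endpoint-++ s [] ys = refl
endpoint-++ s (x ∷ xs) ys = endpoint-++ x xs ys

walk-++ : ∀ {t s xs ys} → WalkFrom t s xs → WalkFrom t (endpoint s xs) ys → WalkFrom t s (xs ++ ys)
walk-++ [] w = w
walk-++ (st ∷ w₁) w₂ = st ∷ walk-++ w₁ w₂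

walk-∷ʳ : ∀ {t s xs y we} → WalkFrom t s xs → Step t (endpoint s xs) y we → WalkFrom t s (xs ∷ʳ y)
walk-∷ʳ w st = walk-++ w (st ∷ [])

endpoint-∷ʳ : ∀ s xs (y : Addr) → endpoint s (xs ∷ʳ y) ≡ y
endpoint-∷ʳ s xs y = endpoint-++ s xs [ y ]

∈-∷-++ʳ : ∀ {x c : Addr} E {W} → x ∈ c ∷ W → x ∈ c ∷ E ++ W
∈-∷-++ʳ E (here refl) = here refl
∈-∷-++ʳ E (there x∈) = there (∈-++⁺ʳ E x∈)

∈-∷-chain : ∀ {x m c : Addr} W₁ {W₂} → m ∈ c ∷ W₁ → x ∈ m ∷ W₂ → x ∈ c ∷ W₁ ++ W₂
∈-∷-chain W₁ m∈ (here refl) = ∈-++⁺ˡ m∈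
∈-∷-chain W₁ m∈ (there x∈) = there (∈-++⁺ʳ W₁ x∈)

endpoint-∈ : ∀ s W → endpoint s W ∈ s ∷ W
endpoint-∈ s [] = here refl
endpoint-∈ _ (y ∷ W) = there (endpoint-∈ y W)

walk-enters-ancestors : ∀ {t s W x y} → WalkFrom t s W → y ∈ W → x ≼ y → ¬ x ≼ s → x ∈ W
walk-enters-ancestors {x = x} (_∷_ {y = y₀} st w) y∈ x≼y x⋠s with x ≼? y₀ | stepView st
... | yes x≼y₀ | up i refl = ⊥-elim (x⋠s (≼-trans x≼y₀ (≼-++ [ i ])))
... | yes x≼y₀ | down i refl with ≼-∷ʳ⁻ x≼y₀
...   | inj₁ x≼s = ⊥-elim (x⋠s x≼s)
...   | inj₂ refl = here refl
walk-enters-ancestors (_ ∷ w) (here refl) x≼y _ | no x⋠y₀ | _ = ⊥-elim (x⋠y₀ x≼y)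
walk-enters-ancestors (_ ∷ w) (there y∈) x≼y _ | no x⋠y₀ | _ = there (walk-enters-ancestors w y∈ x≼y x⋠y₀)

record WalkBetween (t : Tree) (x y : Addr) (P : Addr → Set) (W : List Addr) : Set where
  constructor walkBetween
  field
    walk   : WalkFrom t x W
    ends   : endpoint x W ≡ y
    inside : All P W

-- The tree path from a to b climbs through the prefixes of a of lengths
-- |a| - 1, …, m and then descends through the prefixes of b of lengths
-- m + 1, …, |b|, where m is the length of their common prefix.
ascent : Addr → ℕ → ℕ → List Addr
ascent a m d = applyDownFrom (λ j → take (m + j) a) d

descent : Addr → ℕ → ℕ → List Addr
descent b m d = applyUpTo (λ j → take (suc m + j) b) d

treePath-split : ∀ a b → let m = length (commonPrefix a b) in
  treePath a b ≡ ascent a m (length a ∸ m) ++ descent b m (length b ∸ m)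
treePath-split a b = cong₂ _++_ ascent≡ descent≡
  where
  m = length (commonPrefix a b)
  ascent≡ : reverse (map (λ k → take k a) (map (m +_) (applyUpTo (λ j → j) (length a ∸ m)))) ≡ ascent a m (length a ∸ m)
  ascent≡ = begin
    reverse (map (λ k → take k a) (map (m +_) (applyUpTo (λ j → j) (length a ∸ m))))
      ≡⟨ cong (λ l → reverse (map (λ k → take k a) l)) (List.map-applyUpTo (λ j → j) (m +_) (length a ∸ m)) ⟩
    reverse (map (λ k → take k a) (applyUpTo (m +_) (length a ∸ m)))
      ≡⟨ cong reverse (List.map-applyUpTo (m +_) (λ k → take k a) (length a ∸ m)) ⟩
    reverse (applyUpTo (λ j → take (m + j) a) (length a ∸ m))
      ≡⟨ List.reverse-applyUpTo (λ j → take (m + j) a) (length a ∸ m) ⟩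
    ascent a m (length a ∸ m) ∎
    where open ≡-Reasoning
  descent≡ : map (λ k → take k b) (map (suc m +_) (applyUpTo (λ j → j) (length b ∸ m))) ≡ descent b m (length b ∸ m)
  descent≡ = trans (cong (map (λ k → take k b)) (List.map-applyUpTo (λ j → j) (suc m +_) (length b ∸ m)))
                   (List.map-applyUpTo (suc m +_) (λ k → take k b) (length b ∸ m))

data Arrival (t : Tree) (p b : Addr) : List Addr → Set where
  stay  : p ≡ b → Arrival t p b []
  enter : ∀ {D} → p ≺ b → WalkFrom t p D → Step t (endpoint p D) b (edgeInto t b) →
          All (λ z → p ≺ z × z ≺ b) D → Arrival t p b (D ∷ʳ b)

module _ {t : Tree} where

  step-from : ∀ {x x' y we} → x ≡ x' → Step t x y we → Step t x' y we
  step-from refl st = st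

  ascent-walk : ∀ a m d → m + d ≤ length a → IsVertex t a →
    WalkBetween t (take (m + d) a) (take m a) (λ z → take m a ≼ z × z ≺ take (m + d) a) (ascent a m d)
  ascent-walk a m zero _ _ rewrite ℕ.+-identityʳ m = walkBetween [] refl []
  ascent-walk a m (suc d) le va rewrite ℕ.+-suc m d
    with take-suc-∷ʳ (m + d) a le | ascent-walk a m d (ℕ.<⇒≤ le) va
  ... | i , eq | walkBetween w e ins =
    walkBetween (up i eq (IsVertex-≼ {t} {take (suc (m + d)) a} (take-≼ _ a) va) ∷ w) e
      ((take-mono a (ℕ.m≤m+n m d) , parent) ∷ All.map (λ (p , q) → p , ≺-≼-trans q (proj₁ parent)) ins)
    where
    parent : take (m + d) a ≺ take (suc (m + d)) a
    parent = subst (take (m + d) a ≺_) (sym eq) ≺-∷ʳ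

  descent-last : ∀ b m d → suc (m + d) ≤ length b → IsVertex t b →
    Step t (take (m + d) b) (take (suc (m + d)) b) (edgeInto t (take (suc (m + d)) b)) ×
    take (m + d) b ≺ take (suc (m + d)) b
  descent-last b m d le vb with take-suc-∷ʳ (m + d) b le
  ... | i , eq = down i eq (IsVertex-≼ {t} {take (suc (m + d)) b} (take-≼ _ b) vb) , subst (take (m + d) b ≺_) (sym eq) ≺-∷ʳ

  descent-∷ʳ : ∀ b m d → descent b m (suc d) ≡ descent b m d ∷ʳ take (suc (m + d)) b
  descent-∷ʳ b m d = sym (List.applyUpTo-∷ʳ (λ j → take (suc m + j) b) d)

  descent-walk : ∀ b m d → m + d ≤ length b → IsVertex t b →
    WalkBetween t (take m b) (take (m + d) b) (λ z → take m b ≺ z × z ≼ take (m + d) b) (descent b m d)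
  descent-walk b m zero _ _ rewrite ℕ.+-identityʳ m = walkBetween [] refl []
  descent-walk b m (suc d) le vb rewrite ℕ.+-suc m d | descent-∷ʳ b m d
    with descent-walk b m d (ℕ.<⇒≤ le) vb | descent-last b m d le vb
  ... | walkBetween w e ins | st , child =
    walkBetween (walk-∷ʳ w (step-from (sym e) st)) (endpoint-∷ʳ (take m b) (descent b m d) _)
      (Allₚ.++⁺ (All.map (λ (p , q) → p , ≼-trans q (proj₁ child)) ins)
               ((≼-≺-trans (take-mono b (ℕ.m≤m+n m d)) child , ≼-refl) ∷ []))

  descent-arrival : ∀ b m d → m + d ≡ length b → IsVertex t b → Arrival t (take m b) b (descent b m d)
  descent-arrival b m zero e _ = stay (List.take-all m b (ℕ.≤-reflexive (trans (sym e) (ℕ.+-identityʳ m))))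
  descent-arrival b m (suc d) e vb rewrite descent-∷ʳ b m d
    with descent-walk b m d (ℕ.<⇒≤ le) vb | descent-last b m d le vb
    where le : suc (m + d) ≤ length b
          le = ℕ.≤-reflexive (trans (sym (ℕ.+-suc m d)) e)
  ... | walkBetween w e' ins | st , child =
    subst (λ y → Arrival t (take m b) y (descent b m d ∷ʳ take (suc (m + d)) b)) whole
      (enter (≼-≺-trans (take-mono b (ℕ.m≤m+n m d)) child) w (step-from (sym e') st)
             (All.map (λ (p , q) → p , ≼-≺-trans q child) ins))
    where whole : take (suc (m + d)) b ≡ b
          whole = List.take-all _ b (ℕ.≤-reflexive (trans (sym e) (ℕ.+-suc m d)))

  take-length-∸ : ∀ {p a : Addr} → p ≼ a → take (length p + (length a ∸ length p)) a ≡ a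
  take-length-∸ {p} {a} p≼a =
    trans (cong (λ k → take k a) (ℕ.m+[n∸m]≡n (≼-length p≼a))) (List.take-all (length a) a ≤-refl)

  ascent-from : ∀ {p a} → p ≼ a → IsVertex t a →
    WalkBetween t a p (λ z → p ≼ z × z ≺ a) (ascent a (length p) (length a ∸ length p))
  ascent-from {p} {a} p≼a va =
    subst₂ (λ x y → WalkBetween t x y (λ z → y ≼ z × z ≺ x) (ascent a (length p) (length a ∸ length p)))
      (take-length-∸ p≼a) (take-length-≼ p≼a)
      (ascent-walk a (length p) _ (≤-reflexive (ℕ.m+[n∸m]≡n (≼-length p≼a))) va)

  descent-from : ∀ {p b} → p ≼ b → IsVertex t b →
    WalkBetween t p b (λ z → p ≺ z × z ≼ b) (descent b (length p) (length b ∸ length p))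
  descent-from {p} {b} p≼b vb =
    subst₂ (λ x y → WalkBetween t x y (λ z → x ≺ z × z ≼ y) (descent b (length p) (length b ∸ length p)))
      (take-length-≼ p≼b) (take-length-∸ p≼b)
      (descent-walk b (length p) _ (≤-reflexive (ℕ.m+[n∸m]≡n (≼-length p≼b))) vb)

  descent-arrival-from : ∀ {p b} → p ≼ b → IsVertex t b → Arrival t p b (descent b (length p) (length b ∸ length p))
  descent-arrival-from {p} {b} p≼b vb =
    subst (λ x → Arrival t x b (descent b (length p) (length b ∸ length p))) (take-length-≼ p≼b)
      (descent-arrival b (length p) _ (ℕ.m+[n∸m]≡n (≼-length p≼b)) vb)

  record TreePath (a b : Addr) : Set where
    field
      ascending descending : List Addr
      split   : treePath a b ≡ ascending ++ descending
      climb   : WalkBetween t a (commonPrefix a b) (λ z → commonPrefix a b ≼ z × z ≺ a) ascending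
      sink    : WalkBetween t (commonPrefix a b) b (λ z → commonPrefix a b ≺ z × z ≼ b) descending
      arrival : Arrival t (commonPrefix a b) b descending

  tree-path : ∀ {a b} → IsVertex t a → IsVertex t b → TreePath a b
  tree-path {a} {b} va vb = record
    { split   = treePath-split a b
    ; climb   = ascent-from (commonPrefix-≼ˡ a b) va
    ; sink    = descent-from (commonPrefix-≼ʳ a b) vb
    ; arrival = descent-arrival-from (commonPrefix-≼ʳ a b) vb
    }

  treePath-∈ : ∀ {a b z} → IsVertex t a → IsVertex t b → z ∈ treePath a b → z ≺ a ⊎ z ≼ b
  treePath-∈ {a} {b} {z} va vb z∈ =
    ⊎.map (λ p → proj₂ (All.lookup (inside climb) p)) (λ p → proj₂ (All.lookup (inside sink) p))
          (∈-++⁻ ascending (subst (z ∈_) split z∈))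
    where
    open TreePath (tree-path {a} {b} va vb)
    open WalkBetween

  treePath-reaches : ∀ {a b} → IsVertex t a → IsVertex t b → b ∈ a ∷ treePath a b
  treePath-reaches {a} {b} va vb =
    subst (λ W → b ∈ a ∷ W) (sym split) (subst (_∈ a ∷ ascending ++ descending) whole-ends (endpoint-∈ a _))
    where
    open TreePath (tree-path {a} {b} va vb)
    open WalkBetween
    whole-ends : endpoint a (ascending ++ descending) ≡ b
    whole-ends = trans (endpoint-++ a ascending descending)
                       (trans (cong (λ s → endpoint s descending) (ends climb)) (ends sink))

  treePath-last : ∀ {a b} → IsVertex t a → IsVertex t b → ¬ b ≼ a →
    ∃ λ P → treePath a b ≡ P ∷ʳ b × b ∉ P
  treePath-last {a} {b} va vb b⋠a with tree-path {a} {b} va vb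
  ... | record { ascending = U ; split = split ; climb = climb ; arrival = arrival } with arrival
  ...   | stay p≡b = ⊥-elim (b⋠a (subst (_≼ a) p≡b (commonPrefix-≼ˡ a b)))
  ...   | enter {D₀} _ _ _ inside₀ =
    U ++ D₀ , trans split (sym (++-assoc U D₀ [ b ])) , λ b∈ → [ not-up , not-down ]′ (∈-++⁻ U b∈)
    where
    not-up : b ∉ U
    not-up b∈U = b⋠a (proj₁ (proj₂ (All.lookup (WalkBetween.inside climb) b∈U)))
    not-down : b ∉ D₀
    not-down b∈D₀ = proj₂ (proj₂ (All.lookup inside₀ b∈D₀)) refl

module _ (t : Tree) where

  weight : List Addr → ℕ
  weight [] = 0
  weight (x ∷ xs) = vw t x + weight xs

  weight-++ : ∀ xs ys → weight (xs ++ ys) ≡ weight xs + weight ys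
  weight-++ [] ys = refl
  weight-++ (x ∷ xs) ys rewrite weight-++ xs ys = sym (ℕ.+-assoc (vw t x) (weight xs) (weight ys))

  weight-middle : ∀ xs x ys → weight (xs ++ x ∷ ys) ≡ vw t x + weight (xs ++ ys)
  weight-middle xs x ys = begin
    weight (xs ++ x ∷ ys)            ≡⟨ weight-++ xs (x ∷ ys) ⟩
    weight xs + (vw t x + weight ys) ≡⟨ x∙yz≈y∙xz (weight xs) (vw t x) (weight ys) ⟩
    vw t x + (weight xs + weight ys) ≡⟨ cong (vw t x +_) (sym (weight-++ xs ys)) ⟩
    vw t x + weight (xs ++ ys)       ∎
    where open ≡-Reasoning

  weight-⊆ : ∀ {xs ys} → Unique xs → (∀ {z} → z ∈ xs → z ∈ ys) → weight xs ≤ weight ys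
  weight-⊆ {[]} _ _ = z≤n
  weight-⊆ {x ∷ xs} (x∉xs ∷ u) xs⊆ys with ∈-∃++ (xs⊆ys (here refl))
  ... | ys₁ , ys₂ , refl = subst (vw t x + weight xs ≤_) (sym (weight-middle ys₁ x ys₂))
        (ℕ.+-monoʳ-≤ (vw t x) (weight-⊆ u λ z∈ →
          ∈-remove ys₁ (xs⊆ys (there z∈)) (λ { refl → All.lookup x∉xs z∈ refl })))
    where
    ∈-remove : ∀ {z x : Addr} ys₁ {ys₂} → z ∈ ys₁ ++ x ∷ ys₂ → z ≢ x → z ∈ ys₁ ++ ys₂
    ∈-remove [] (here refl) z≢x = ⊥-elim (z≢x refl)
    ∈-remove [] (there p) _ = p
    ∈-remove (_ ∷ _) (here refl) _ = here refl
    ∈-remove (_ ∷ ys₁) (there p) z≢x = there (∈-remove ys₁ p z≢x)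

  fill-total : ∀ {k} y vis → vw t y ≤ k → k ∸ vw t y + weight (y ∷ vis) ≡ k + weight vis
  fill-total {k} y vis vw≤k = begin
    k ∸ vw t y + (vw t y + weight vis) ≡⟨ sym (ℕ.+-assoc (k ∸ vw t y) (vw t y) (weight vis)) ⟩
    k ∸ vw t y + vw t y + weight vis   ≡⟨ cong (_+ weight vis) (ℕ.m∸n+n≡m vw≤k) ⟩
    k + weight vis                      ∎
    where open ≡-Reasoning

  start-total : ∀ {k} → vw t [] ≤ k → k ∸ vw t [] + weight ([] ∷ []) ≡ k
  start-total {k} vw≤k = trans (fill-total [] [] vw≤k) (ℕ.+-identityʳ k)

  run-weight : ∀ {k vis cur W fin} → Run t k vis cur W fin → weight fin ≤ k + weight vis
  run-weight stop = ℕ.m≤n+m _ _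
  run-weight (moveOld _ _ _ r) = run-weight r
  run-weight {vis = vis} (moveNew {y = y} _ _ _ vw≤k r) = ≤-trans (run-weight r) (≤-reflexive (fill-total y vis vw≤k))

  solves-weight : ∀ {bt k W vis} → Solves t bt k W → Unique vis → All (IsVertex t) vis → weight vis ≤ k
  solves-weight (_ , vw≤k , run , cover , _) u vs =
    ≤-trans (weight-⊆ u (λ z∈ → cover _ (All.lookup vs z∈))) (≤-trans (run-weight run) (≤-reflexive (start-total vw≤k)))

-- Dominating edges

module Dom {t r b v} (d : Dom t r b v) where

  root≺ : r ≺ v
  root≺ = proj₁ d

  ≼leaf : v ≼ b
  ≼leaf = proj₁ (proj₂ d)

  above< : ∀ w → r ≺ w → w ≺ v → edgeInto t w < edgeInto t v
  above< = proj₁ (proj₂ (proj₂ d))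

  below≤ : ∀ w → v ≺ w → w ≼ b → edgeInto t w ≤ edgeInto t v
  below≤ = proj₂ (proj₂ (proj₂ d))

  path≤ : ∀ u → r ≺ u → u ≼ v → edgeInto t u ≤ edgeInto t v
  path≤ u r≺u u≼v with u ≟A v
  ... | yes refl = ≤-refl
  ... | no u≢v = ℕ.<⇒≤ (above< u r≺u (u≼v , u≢v))

Dom-unique : ∀ {t r b v v'} → Dom t r b v → Dom t r b v' → v ≡ v'
Dom-unique {v = v} {v'} d d' with v ≟A v' | ≼-comparable (Dom.≼leaf d) (Dom.≼leaf d')
... | yes v≡v' | _ = v≡v'
... | no v≢v' | inj₁ v≼v' =
  ⊥-elim (ℕ.<⇒≱ (Dom.above< d' v (Dom.root≺ d) (v≼v' , v≢v')) (Dom.below≤ d v' (v≼v' , v≢v') (Dom.≼leaf d')))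
... | no v≢v' | inj₂ v'≼v =
  ⊥-elim (ℕ.<⇒≱ (Dom.above< d v' (Dom.root≺ d') (v'≼v , v≢v' ∘ sym))
                (Dom.below≤ d' v (v'≼v , v≢v' ∘ sym) (Dom.≼leaf d)))

Dom-child : ∀ {t r i} → Dom t r (r ∷ʳ i) (r ∷ʳ i)
Dom-child = ≺-∷ʳ , ≼-refl , (λ w r≺w w≺ri → ⊥-elim (proj₂ r≺w (≼-antisym (proj₁ r≺w) (≺-∷ʳ⁻ w≺ri))))
          , (λ w ri≺w w≼ri → ⊥-elim (≺⇒⋡ ri≺w w≼ri))

-- Extending the path by one edge either keeps the dominating edge or, if
-- the new edge is strictly heavier, makes the new edge dominating.
Dom-∷ʳ : ∀ {t r b v} i → Dom t r b v → ∃ (Dom t r (b ∷ʳ i))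
Dom-∷ʳ {t} {r} {b} {v} i d with edgeInto t v ℕ.<? edgeInto t (b ∷ʳ i)
... | yes v<bi =
  b ∷ʳ i , ≺-≼-trans (Dom.root≺ d) (≼-trans (Dom.≼leaf d) (≼-++ [ i ])) , ≼-refl , above ,
  (λ w bi≺w w≼bi → ⊥-elim (≺⇒⋡ bi≺w w≼bi))
  where
  above : ∀ w → r ≺ w → w ≺ (b ∷ʳ i) → edgeInto t w < edgeInto t (b ∷ʳ i)
  above w r≺w w≺bi with w ≟A v | ≼-comparable (≺-∷ʳ⁻ w≺bi) (Dom.≼leaf d)
  ... | yes refl | _ = v<bi
  ... | no w≢v | inj₁ w≼v = ℕ.<-trans (Dom.above< d w r≺w (w≼v , w≢v)) v<bi
  ... | no w≢v | inj₂ v≼w = ℕ.≤-<-trans (Dom.below≤ d w (v≼w , w≢v ∘ sym) (≺-∷ʳ⁻ w≺bi)) v<bi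
... | no v≮bi = v , Dom.root≺ d , ≼-trans (Dom.≼leaf d) (≼-++ [ i ]) , Dom.above< d , below
  where
  below : ∀ w → v ≺ w → w ≼ (b ∷ʳ i) → edgeInto t w ≤ edgeInto t v
  below w v≺w w≼bi with ≼-∷ʳ⁻ w≼bi
  ... | inj₁ w≼b = Dom.below≤ d w v≺w w≼b
  ... | inj₂ refl = ℕ.≮⇒≥ v≮bi

Dom-exists : ∀ {t r b} → r ≺ b → ∃ (Dom t r b)
Dom-exists {t} {r} ((s , refl) , r≢b) = go s (reverseView s) (λ { refl → r≢b (sym (++-identityʳ r)) })
  where
  go : ∀ s → Reverse s → s ≢ [] → ∃ (Dom t r (r ++ s))
  go _ [] s≢[] = ⊥-elim (s≢[] refl)
  go _ ([] ∶ _ ∶ʳ i) _ = r ∷ʳ i , Dom-child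
  go _ (xs@(_ ∷ _) ∶ rs ∶ʳ i) _ =
    subst (λ b → ∃ (Dom t r b)) (++-assoc r xs [ i ]) (Dom-∷ʳ i (proj₂ (go xs rs (λ ()))))

module OrderSpec {t r L vC hi lo} (os : OrderSpec t r L vC hi lo) where

  hi-root : ∀ {v} → v ∈ hi → IsCRoot t r L v × edgeInto t vC < edgeInto t v
  hi-root {v} = Equivalence.to (proj₁ (proj₂ (proj₂ os)) v)

  hi-complete : ∀ {v} → IsCRoot t r L v → edgeInto t vC < edgeInto t v → v ∈ hi
  hi-complete {v} cr lt = Equivalence.from (proj₁ (proj₂ (proj₂ os)) v) (cr , lt)

  lo-root : ∀ {v} → v ∈ lo → IsCRoot t r L v × v ≢ vC × edgeInto t v ≤ edgeInto t vC
  lo-root {v} = Equivalence.to (proj₁ (proj₂ (proj₂ (proj₂ os))) v)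

  lo-complete : ∀ {v} → IsCRoot t r L v → v ≢ vC → edgeInto t v ≤ edgeInto t vC → v ∈ lo
  lo-complete {v} cr ne le = Equivalence.from (proj₁ (proj₂ (proj₂ (proj₂ os))) v) (cr , ne , le)

  others : All (λ v → IsCRoot t r L v × v ≢ vC) (hi ++ lo)
  others = All.tabulate λ v∈ → [ hi-other , lo-other ]′ (∈-++⁻ hi v∈)
    where
    hi-other : ∀ {v} → v ∈ hi → IsCRoot t r L v × v ≢ vC
    hi-other v∈ with hi-root v∈
    ... | cr , vC<v = cr , λ { refl → ℕ.<-irrefl refl vC<v }
    lo-other : ∀ {v} → v ∈ lo → IsCRoot t r L v × v ≢ vC
    lo-other v∈ with lo-root v∈
    ... | cr , v≢vC , _ = cr , v≢vC

  roots : All (IsCRoot t r L) (hi ++ lo)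
  roots = All.map proj₁ others

  other-complete : ∀ {v} → IsCRoot t r L v → v ≢ vC → v ∈ hi ++ lo
  other-complete {v} cr v≢vC with edgeInto t vC ℕ.<? edgeInto t v
  ... | yes vC<v = ∈-++⁺ˡ (hi-complete cr vC<v)
  ... | no vC≮v = ∈-++⁺ʳ hi (lo-complete cr v≢vC (ℕ.≮⇒≥ vC≮v))

  hi-descending : Linked (λ x y → edgeInto t y ≤ edgeInto t x) hi
  hi-descending = proj₂ (proj₂ (proj₂ (proj₂ os)))

-- The lower bound

PrefixClosed : List Addr → Set
PrefixClosed vis = ∀ {x z} → z ≼ x → x ∈ vis → z ∈ vis

PrefixClosed-fill : ∀ {t cur y we vis} → Step t cur y we → PrefixClosed vis → cur ∈ vis → y ∉ vis → PrefixClosed (y ∷ vis)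
PrefixClosed-fill st closed cur∈ y∉ z≼x (there x∈) = there (closed z≼x x∈)
PrefixClosed-fill st closed cur∈ y∉ z≼x (here refl) with stepView st
... | up i refl = ⊥-elim (y∉ (closed (≼-++ [ i ]) cur∈))
... | down i refl with ≼-∷ʳ⁻ z≼x
...   | inj₁ z≼cur = there (closed z≼cur cur∈)
...   | inj₂ refl = here refl

run-newest : ∀ {t k vis cur W fin} → Run t k vis cur W fin →
  fin ≡ vis ⊎ ∃ λ z → ∃ λ rest → fin ≡ z ∷ rest × z ∉ vis
run-newest stop = inj₁ refl
run-newest (moveOld _ _ _ r) = run-newest r
run-newest {vis = vis} (moveNew {y = y} _ _ y∉ _ r) with run-newest r
... | inj₁ refl = inj₂ (y , vis , refl , y∉)
... | inj₂ (z , rest , e , z∉) = inj₂ (z , rest , e , λ p → z∉ (there p))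

module Separation (t : Tree) (bt : Addr) where

  -- the edge into w lies on the tree path between x and bt
  Separates : Addr → Addr → Set
  Separates w x = (w ≼ x × ¬ w ≼ bt) ⊎ (w ≼ bt × ¬ w ≼ x)

  Heavy : ℕ → Addr → Set
  Heavy c x = ∃ λ w → c ≤ edgeInto t w × Separates w x

  Light : ℕ → Addr → Set
  Light c x = ∀ w → Separates w x → edgeInto t w < c

  AboveHeavy : ℕ → Addr → Set
  AboveHeavy c z = ∃ λ x → IsVertex t x × z ≼ x × Heavy c x

  AboveHeavy-mono : ∀ {c c' z} → c' ≤ c → AboveHeavy c z → AboveHeavy c' z
  AboveHeavy-mono c'≤c (x , vx , z≼x , w , c≤w , sep) = x , vx , z≼x , w , ≤-trans c'≤c c≤w , sep

  light-bt : ∀ {c} → Light c bt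
  light-bt w (inj₁ (w≼bt , w⋠bt)) = ⊥-elim (w⋠bt w≼bt)
  light-bt w (inj₂ (w≼bt , w⋠bt)) = ⊥-elim (w⋠bt w≼bt)

  heavy⇒¬light : ∀ {c x} → Heavy c x → ¬ Light c x
  heavy⇒¬light (w , c≤w , sep) light = ℕ.≤⇒≯ c≤w (light w sep)

  light-step⁻ : ∀ {c cur y we} → Step t cur y we → we < c → Light c y → Light c cur
  light-step⁻ st we<c light-y w sep with stepView st | sep
  ... | down i refl | inj₁ (w≼cur , w⋠bt) = light-y w (inj₁ (≼-trans w≼cur (≼-++ [ i ]) , w⋠bt))
  ... | down i refl | inj₂ (w≼bt , w⋠cur) with w ≼? (_ ∷ʳ i)
  ...   | no w⋠y = light-y w (inj₂ (w≼bt , w⋠y))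
  ...   | yes w≼y with ≼-∷ʳ⁻ w≼y
  ...     | inj₁ w≼cur = ⊥-elim (w⋠cur w≼cur)
  ...     | inj₂ refl = we<c
  light-step⁻ st we<c light-y w sep | up i refl | inj₁ (w≼cur , w⋠bt) with ≼-∷ʳ⁻ w≼cur
  ... | inj₁ w≼y = light-y w (inj₁ (w≼y , w⋠bt))
  ... | inj₂ refl = we<c
  light-step⁻ st we<c light-y w sep | up i refl | inj₂ (w≼bt , w⋠cur) =
    light-y w (inj₂ (w≼bt , λ w≼y → w⋠cur (≼-trans w≼y (≼-++ [ i ]))))

  HeavyFilled : ℕ → List Addr → Set
  HeavyFilled c vis = ∀ {x} → IsVertex t x → Heavy c x → x ∈ vis

  -- A moment at which an edge of weight at least c was crossed while the
  -- prefix-closed set `before` of filled vertices contained every c-heavy vertex.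
  record HeavyCrossing (c k : ℕ) (vis : List Addr) : Set where
    field
      before : List Addr
      enough : c + weight t before ≤ k + weight t vis
      heavy  : HeavyFilled c before
      closed : PrefixClosed before

  crossing-at : ∀ {c k vis cur y we} → Step t cur y we → we ≤ k → PrefixClosed vis → HeavyFilled c vis →
    Light c y → HeavyCrossing c k vis ⊎ (Light c cur × HeavyFilled c vis)
  crossing-at {c} {vis = vis} {we = we} st we≤k closed heavy light-y with we ℕ.<? c
  ... | yes we<c = inj₂ (light-step⁻ st we<c light-y , heavy)
  ... | no we≮c = inj₁ record
    { before = vis ; enough = ℕ.+-monoˡ-≤ (weight t vis) (≤-trans (ℕ.≮⇒≥ we≮c) we≤k) ; heavy = heavy ; closed = closed }

  last-heavy-crossing : ∀ {c k vis cur W fin rest} → Run t k vis cur W fin →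
    PrefixClosed vis → cur ∈ vis → bt ∉ vis → fin ≡ bt ∷ rest → HeavyFilled c fin →
    HeavyCrossing c k vis ⊎ (Light c cur × HeavyFilled c vis)
  last-heavy-crossing stop _ _ bt∉ refl _ = ⊥-elim (bt∉ (here refl))
  last-heavy-crossing (moveOld st we≤k y∈ r) closed cur∈ bt∉ last heavy
    with last-heavy-crossing r closed y∈ bt∉ last heavy
  ... | inj₁ crossing = inj₁ crossing
  ... | inj₂ (light-y , heavy-vis) = crossing-at st we≤k closed heavy-vis light-y
  last-heavy-crossing {c} {vis = vis} (moveNew {y = y} st we≤k y∉ vw≤k r) closed cur∈ bt∉ last heavy with y ≟A bt
  ... | yes refl = crossing-at st we≤k closed heavy-vis light-bt
    where
    fin≡ : _ ≡ bt ∷ vis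
    fin≡ with run-newest r
    ... | inj₁ e = e
    ... | inj₂ (z , _ , e , z∉) with trans (sym last) e
    ...   | refl = ⊥-elim (z∉ (here refl))
    heavy-vis : HeavyFilled c vis
    heavy-vis vx hx with subst (_ ∈_) fin≡ (heavy vx hx)
    ... | here refl = ⊥-elim (heavy⇒¬light hx light-bt)
    ... | there x∈ = x∈
  ... | no y≢bt with last-heavy-crossing r (PrefixClosed-fill st closed cur∈ y∉) (here refl)
                       (λ { (here e) → y≢bt (sym e) ; (there p) → bt∉ p }) last heavy
  ...   | inj₁ record { before = before ; enough = enough ; heavy = heavy ; closed = closed } =
    inj₁ record { before = before ; enough = ≤-trans enough (≤-reflexive (fill-total t y vis vw≤k)) ; heavy = heavy ; closed = closed }
  ...   | inj₂ (light-y , heavy-y∷vis) = crossing-at st we≤k closed heavy-vis light-y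
    where
    heavy-vis : HeavyFilled c vis
    heavy-vis vx hx with heavy-y∷vis vx hx
    ... | here refl = ⊥-elim (heavy⇒¬light hx light-y)
    ... | there x∈ = x∈

  crossing-bound : ∀ {c k W vis} → Solves t bt k W → bt ≢ [] → Unique vis → All (AboveHeavy c) vis →
    ∀ {z} → z ∈ vis → c + weight t vis ≤ k
  crossing-bound {c} {vis = vis} (_ , vw≤k , run , cover , _ , last) bt≢[] u above z∈
    with last-heavy-crossing run closed₀ (here refl) bt∉₀ last (λ vx _ → cover _ vx)
    where
    closed₀ : PrefixClosed ([] ∷ [])
    closed₀ z≼x (here refl) rewrite ≼-[] z≼x = here refl
    bt∉₀ : bt ∉ [] ∷ []
    bt∉₀ (here e) = bt≢[] e
  ... | inj₁ record { before = before ; enough = enough ; heavy = heavy ; closed = closed } =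
    ≤-trans (ℕ.+-monoʳ-≤ c (weight-⊆ t u vis⊆before)) (≤-trans enough (≤-reflexive (start-total t vw≤k)))
    where
    vis⊆before : ∀ {y} → y ∈ vis → y ∈ before
    vis⊆before y∈ with All.lookup above y∈
    ... | x , vx , y≼x , hx = closed y≼x (heavy vx hx)
  ... | inj₂ (light₀ , heavy₀) with All.lookup above z∈
  ...   | x , vx , _ , hx with heavy₀ vx hx
  ...     | here refl = ⊥-elim (heavy⇒¬light hx light₀)

  data Insert (y : Addr) (vis : List Addr) : List Addr → Set where
    old : y ∈ vis → Insert y vis vis
    new : y ∉ vis → Insert y vis (y ∷ vis)

  insert : ∀ y vis → ∃ (Insert y vis)
  insert y vis with y ∈? vis
    where open import Data.List.Membership.DecPropositional _≟A_ using (_∈?_)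
  ... | yes y∈ = vis , old y∈
  ... | no y∉ = y ∷ vis , new y∉

  Insert-All : ∀ {P : Addr → Set} {y vis vis'} → Insert y vis vis' → All P vis → P y → All P vis'
  Insert-All (old _) ps _ = ps
  Insert-All (new _) ps py = py ∷ ps

  Insert-∈ : ∀ {y z vis vis'} → Insert y vis vis' → z ∈ vis → z ∈ vis'
  Insert-∈ (old _) z∈ = z∈
  Insert-∈ (new _) z∈ = there z∈

  Insert-inserted : ∀ {y vis vis'} → Insert y vis vis' → y ∈ vis'
  Insert-inserted (old y∈) = y∈
  Insert-inserted (new _) = here refl

  Insert-Unique : ∀ {y vis vis'} → Insert y vis vis' → Unique vis → Unique vis'
  Insert-Unique (old _) u = u
  Insert-Unique {y} {vis} (new y∉) u = All.tabulate (λ {z} z∈ y≡z → y∉ (subst (_∈ vis) (sym y≡z) z∈)) ∷ u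

  Insert-weight : ∀ {y vis vis'} → Insert y vis vis' → weight t vis ≤ weight t vis'
  Insert-weight (old _) = ≤-refl
  Insert-weight (new _) = ℕ.m≤n+m _ _

  -- A walk in which every edge of positive weight we is crossed only when each
  -- filled vertex lies above a we-heavy vertex.  By crossing-bound, no strategy
  -- ending at bt gets by with fewer agents than the peak of such a walk.
  data Plan : List Addr → Addr → List Addr → Set where
    done : ∀ {vis cur} → Plan vis cur []
    step : ∀ {vis vis' cur y we W} → Step t cur y we → we ≡ 0 ⊎ All (AboveHeavy we) vis →
           Insert y vis vis' → Plan vis' y W → Plan vis cur (y ∷ W)

  filled : ∀ {vis cur W} → Plan vis cur W → List Addr
  filled {vis} done = vis
  filled (step _ _ _ p) = filled p

  peak : ∀ {vis cur W} → Plan vis cur W → ℕ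
  peak {vis} done = weight t vis
  peak {vis} (step {we = we} _ _ _ p) = (we + weight t vis) ⊔ peak p

  weight≤peak : ∀ {vis cur W} (p : Plan vis cur W) → weight t vis ≤ peak p
  weight≤peak done = ≤-refl
  weight≤peak {vis} (step {we = we} _ _ ins p) =
    ≤-trans (≤-trans (Insert-weight ins) (weight≤peak p)) (ℕ.m≤n⊔m (we + weight t vis) (peak p))

  -- Runs indexed by the total number of agents K rather than by those still moving.
  run-step : ∀ {K vis vis' cur y we W fin} → Step t cur y we → Insert y vis vis' → we + weight t vis ≤ K →
    weight t vis' ≤ K → Run t (K ∸ weight t vis') vis' y W fin → Run t (K ∸ weight t vis) vis cur (y ∷ W) fin
  run-step {we = we} st (old y∈) we+vis≤K _ r = moveOld st (ℕ.m+n≤o⇒m≤o∸n we we+vis≤K) y∈ r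
  run-step {K} {vis} {y = y} {we} {W} {fin} st (new y∉) we+vis≤K y∷vis≤K r =
    moveNew st (ℕ.m+n≤o⇒m≤o∸n we we+vis≤K) y∉ (ℕ.m+n≤o⇒m≤o∸n (vw t y) y∷vis≤K)
      (subst (λ k → Run t k (y ∷ vis) y W fin) remaining r)
    where
    remaining : K ∸ (vw t y + weight t vis) ≡ K ∸ weight t vis ∸ vw t y
    remaining = trans (cong (K ∸_) (ℕ.+-comm (vw t y) (weight t vis))) (sym (ℕ.∸-+-assoc K (weight t vis) (vw t y)))

  plan-run : ∀ {vis cur W} (p : Plan vis cur W) K → peak p ≤ K → Run t (K ∸ weight t vis) vis cur W (filled p)
  plan-run done K _ = stop
  plan-run {vis} (step {we = we} st _ ins p) K peak≤K =
    run-step st ins (ℕ.m⊔n≤o⇒m≤o (we + weight t vis) (peak p) peak≤K) (≤-trans (weight≤peak p) rest≤K) (plan-run p K rest≤K)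
    where
    rest≤K = ℕ.m⊔n≤o⇒n≤o (we + weight t vis) (peak p) peak≤K

  peak-bound : ∀ {vis cur W k W'} (p : Plan vis cur W) → Solves t bt k W' → bt ≢ [] →
    Unique vis → All (IsVertex t) vis → [] ∈ vis → peak p ≤ k
  peak-bound done sol _ u vs _ = solves-weight t sol u vs
  peak-bound {vis} (step {we = we} st cheap ins p) sol bt≢[] u vs root∈ =
    ℕ.⊔-lub (crossing cheap)
      (peak-bound p sol bt≢[] (Insert-Unique ins u) (Insert-All ins vs (Step⇒IsVertex st)) (Insert-∈ ins root∈))
    where
    crossing : we ≡ 0 ⊎ All (AboveHeavy we) vis → we + weight t vis ≤ _
    crossing (inj₁ refl) = solves-weight t sol u vs
    crossing (inj₂ above) = crossing-bound sol bt≢[] u above root∈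

  plan-walk : ∀ {vis cur W} → Plan vis cur W → WalkFrom t cur W
  plan-walk done = []
  plan-walk (step st _ _ p) = st ∷ plan-walk p

  filled-⊇-vis : ∀ {vis cur W z} (p : Plan vis cur W) → z ∈ vis → z ∈ filled p
  filled-⊇-vis done z∈ = z∈
  filled-⊇-vis (step _ _ ins p) z∈ = filled-⊇-vis p (Insert-∈ ins z∈)

  filled-⊇-walk : ∀ {vis cur W z} (p : Plan vis cur W) → z ∈ W → z ∈ filled p
  filled-⊇-walk (step _ _ ins p) (here refl) = filled-⊇-vis p (Insert-inserted ins)
  filled-⊇-walk (step _ _ _ p) (there z∈) = filled-⊇-walk p z∈

  filled-last : ∀ {vis cur y} W₀ (p : Plan vis cur (W₀ ∷ʳ y)) → y ∉ vis → y ∉ W₀ → ∃ λ rest → filled p ≡ y ∷ rest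
  filled-last [] (step _ _ (old y∈) done) y∉ _ = ⊥-elim (y∉ y∈)
  filled-last {vis} [] (step _ _ (new _) done) _ _ = vis , refl
  filled-last (_ ∷ W₀) (step _ _ (old _) p) y∉ y∉W = filled-last W₀ p y∉ (λ q → y∉W (there q))
  filled-last (_ ∷ W₀) (step _ _ (new _) p) y∉ y∉W =
    filled-last W₀ p (λ { (here e) → y∉W (here e) ; (there q) → y∉ q }) (λ q → y∉W (there q))

  EndsAtBt : List Addr → Set
  EndsAtBt W = ∃ λ W₀ → W ≡ W₀ ∷ʳ bt × bt ∉ W₀

  EndsAtBt-++ : ∀ {X Y} → bt ∉ X → EndsAtBt Y → EndsAtBt (X ++ Y)
  EndsAtBt-++ {X} bt∉X (Y₀ , refl , bt∉Y₀) =
    X ++ Y₀ , sym (++-assoc X Y₀ [ bt ]) , λ bt∈ → [ bt∉X , bt∉Y₀ ]′ (∈-++⁻ X bt∈)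

  root-is-vertex : IsVertex t []
  root-is-vertex = t , refl

  plan-last : ∀ {W} (p : Plan ([] ∷ []) [] W) → ([] ≡ bt × W ≡ []) ⊎ (¬ bt ≼ [] × EndsAtBt W) →
    ∃ λ rest → filled p ≡ bt ∷ rest
  plan-last p (inj₂ (bt⋠[] , W₀ , refl , bt∉W₀)) =
    filled-last W₀ p (λ { (here bt≡[]) → bt⋠[] (subst (bt ≼_) bt≡[] ≼-refl) }) bt∉W₀
  plan-last done (inj₁ ([]≡bt , _)) = [] , cong (_∷ []) []≡bt
  plan-last (step _ _ _ _) (inj₁ (_ , ()))

  plan-solves : ∀ {W} (p : Plan ([] ∷ []) [] W) → (∀ v → IsVertex t v → v ∈ filled p) →
    (∃ λ rest → filled p ≡ bt ∷ rest) → Solves t bt (peak p) W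
  plan-solves {W} p covers last = filled p , ≤-trans (ℕ.m≤m+n (vw t []) 0) (weight≤peak p) , run , covers , last
    where
    run : Run t (peak p ∸ vw t []) ([] ∷ []) [] W (filled p)
    run = subst (λ w → Run t (peak p ∸ w) ([] ∷ []) [] W (filled p)) (ℕ.+-identityʳ (vw t [])) (plan-run p (peak p) ≤-refl)

  plan-optimal : ∀ {W k W'} (p : Plan ([] ∷ []) [] W) → bt ≢ [] ⊎ W ≡ [] → Solves t bt k W' → peak p ≤ k
  plan-optimal p (inj₁ bt≢[]) sol = peak-bound p sol bt≢[] ([] ∷ []) (root-is-vertex ∷ []) (here refl)
  plan-optimal done (inj₂ _) sol = solves-weight t {vis = [] ∷ []} sol ([] ∷ []) (root-is-vertex ∷ [])
  plan-optimal (step _ _ _ _) (inj₂ ())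

  PlanFrom : (Addr → Set) → Addr → List Addr → Set
  PlanFrom Q a W = ∀ {vis} → All Q vis → Plan vis a W

  record Capped (θ : ℕ) (R : Addr → Set) : Set where
    field
      base  : Addr
      below : ∀ {z} → R z → base ≼ z
      edges : ∀ {u} → base ≺ u → R u → edgeInto t u ≤ θ

  Capped-step : ∀ {θ R x y we} → Capped θ R → Step t x y we → R x → R y → we ≤ θ
  Capped-step capped st rx ry with stepView st
  ... | down i refl = Capped.edges capped (≼-≺-trans (Capped.below capped rx) ≺-∷ʳ) ry
  ... | up i refl = Capped.edges capped (≼-≺-trans (Capped.below capped ry) ≺-∷ʳ) rx

  walk-plan : ∀ {θ R s W Rest} → Capped θ R → WalkFrom t s W → R s → All R W → All (AboveHeavy θ) W →
    PlanFrom (AboveHeavy θ) (endpoint s W) Rest → PlanFrom (AboveHeavy θ) s (W ++ Rest)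
  walk-plan capped [] _ _ _ k = k
  walk-plan {θ} capped (_∷_ {y = y} st w) rs (ry ∷ rW) (ay ∷ aW) k {vis} avis with insert y vis
  ... | vis' , ins = step st (inj₂ (All.map (AboveHeavy-mono (Capped-step capped st rs ry)) avis)) ins
                       (walk-plan capped w ry rW aW k (Insert-All ins avis ay))

-- The procedure never needs more agents than the lower bound

module Procedure (t : Tree) (bt : Addr) (bt-leaf : IsLeaf t bt) where
  open Separation t bt

  bt-vertex : IsVertex t bt
  bt-vertex = IsLeaf⇒IsVertex {t} {bt} bt-leaf

  record Level (r : Addr) (L : Addr → Set) : Set where
    field
      root-vertex : IsVertex t r
      leaf        : ∀ b → L b → IsLeaf t b
      below-root  : ∀ b → L b → r ≼ b

  start-threshold : List Addr → Addr → ℕ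
  start-threshold [] vC = edgeInto t vC
  start-threshold (v ∷ _) _ = edgeInto t v

  proc-threshold : ∀ {r L W} → Proc t bt r L W → ℕ
  proc-threshold finished = 0
  proc-threshold (level {vC = vC} {hi = hi} _ _ _ _) = start-threshold hi vC

  module AtLevel {r L vC} (ℓ : Level r L) (dC : Dom t r bt vC) where
    open Level ℓ

    CRoot-vertex : ∀ {v} → IsCRoot t r L v → IsVertex t v
    CRoot-vertex (b , Lb , dv) = IsVertex-≼ (Dom.≼leaf dv) (IsLeaf⇒IsVertex {t} {b} (leaf b Lb))

    InC-vertex : ∀ {v z} → InC t r L v z → IsVertex t z
    InC-vertex (b , (Lb , _) , _ , z≼b) = IsVertex-≼ z≼b (IsLeaf⇒IsVertex {t} {b} (leaf b Lb))

    InC-root : ∀ {v} → IsCRoot t r L v → InC t r L v v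
    InC-root (b , Lb , dv) = b , (Lb , dv) , ≼-refl , Dom.≼leaf dv

    InC-edge : ∀ {v u} → v ≺ u → InC t r L v u → edgeInto t u ≤ edgeInto t v
    InC-edge {u = u} v≺u (_ , (_ , dv) , _ , u≼b) = Dom.below≤ dv u v≺u u≼b

    hi-off-path : ∀ {v} → IsCRoot t r L v → edgeInto t vC < edgeInto t v → ¬ v ≼ bt
    hi-off-path {v} (_ , _ , dv) vC<v v≼bt with v ≟A vC | ≼-comparable v≼bt (Dom.≼leaf dC)
    ... | yes refl | _ = ℕ.<-irrefl refl vC<v
    ... | no v≢vC | inj₁ v≼vC = ℕ.<-asym vC<v (Dom.above< dC v (Dom.root≺ dv) (v≼vC , v≢vC))
    ... | no v≢vC | inj₂ vC≼v = ℕ.<⇒≱ vC<v (Dom.below≤ dC v (vC≼v , v≢vC ∘ sym) v≼bt)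

    lo-apart : ∀ {b v} → Dom t r b v → v ≢ vC → edgeInto t v ≤ edgeInto t vC → ¬ vC ≼ b
    lo-apart {v = v} dv v≢vC v≤vC vC≼b with ≼-comparable (Dom.≼leaf dv) vC≼b
    ... | inj₁ v≼vC = ℕ.<⇒≱ (Dom.above< dC v (Dom.root≺ dv) (v≼vC , v≢vC)) (Dom.below≤ dv vC (v≼vC , v≢vC) vC≼b)
    ... | inj₂ vC≼v = ℕ.<⇒≱ (Dom.above< dv vC (Dom.root≺ dC) (vC≼v , v≢vC ∘ sym)) v≤vC

    record Position (θ : ℕ) (a : Addr) : Set where
      field
        vertex : IsVertex t a
        root≼  : r ≼ a
        above  : ∀ {z} → r ≼ z → z ≺ a → AboveHeavy θ z
        edges  : ∀ {u} → r ≺ u → u ≼ a → edgeInto t u ≤ θ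

    record Target (θ : ℕ) (v : Addr) : Set where
      field
        position     : Position θ v
        root-inside  : InC t r L v v
        inside       : ∀ {z} → InC t r L v z → AboveHeavy θ z
        inside-edges : ∀ {u} → v ≺ u → InC t r L v u → edgeInto t u ≤ θ

    start-position : ∀ {θ} → Position θ r
    start-position = record
      { vertex = root-vertex ; root≼ = ≼-refl
      ; above = λ r≼z z≺r → ⊥-elim (≺⇒⋡ z≺r r≼z) ; edges = λ r≺u u≼r → ⊥-elim (≺⇒⋡ r≺u u≼r) }

    vC-vertex : IsVertex t vC
    vC-vertex = IsVertex-≼ (Dom.≼leaf dC) bt-vertex

    vC-position : Position (edgeInto t vC) vC
    vC-position = record
      { vertex = vC-vertex ; root≼ = proj₁ (Dom.root≺ dC)
      ; above = λ _ z≺vC →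
          _ , IsVertex-≼ (proj₁ z≺vC) vC-vertex , ≼-refl , vC , ≤-refl , inj₂ (Dom.≼leaf dC , ≺⇒⋡ z≺vC)
      ; edges = λ {u} → Dom.path≤ dC u }

    -- A root heavier than vC is off the path to bt, so its own edge separates it from bt.
    hi-target : ∀ {v} → IsCRoot t r L v → edgeInto t vC < edgeInto t v → Target (edgeInto t v) v
    hi-target {v} cr@(_ , _ , dv) vC<v = record
      { position = record
        { vertex = CRoot-vertex cr ; root≼ = proj₁ (Dom.root≺ dv)
        ; above = λ _ z≺v → v , CRoot-vertex cr , proj₁ z≺v , separated ≼-refl
        ; edges = λ {u} → Dom.path≤ dv u }
      ; root-inside = InC-root cr
      ; inside = λ ic → _ , InC-vertex ic , ≼-refl , separated (proj₁ (proj₂ (proj₂ ic)))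
      ; inside-edges = InC-edge }
      where
      separated : ∀ {x} → v ≼ x → Heavy (edgeInto t v) x
      separated v≼x = v , ≤-refl , inj₁ (v≼x , hi-off-path cr vC<v)

    -- A root no heavier than vC hangs off the path to bt, so the edge into vC separates it from bt.
    lo-target : ∀ {v} → IsCRoot t r L v → v ≢ vC → edgeInto t v ≤ edgeInto t vC → Target (edgeInto t vC) v
    lo-target {v} cr@(_ , _ , dv) v≢vC v≤vC = record
      { position = record
        { vertex = CRoot-vertex cr ; root≼ = proj₁ (Dom.root≺ dv)
        ; above = λ _ z≺v →
            _ , IsVertex-≼ (proj₁ z≺v) (CRoot-vertex cr) , ≼-refl , separated dv (≼-trans (proj₁ z≺v) (Dom.≼leaf dv))
        ; edges = λ {u} r≺u u≼v → ≤-trans (Dom.path≤ dv u r≺u u≼v) v≤vC }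
      ; root-inside = InC-root cr
      ; inside = λ { ic@(_ , (_ , dv') , _ , z≼b') → _ , InC-vertex ic , ≼-refl , separated dv' z≼b' }
      ; inside-edges = λ v≺u ic → ≤-trans (InC-edge v≺u ic) v≤vC }
      where
      separated : ∀ {b' z} → Dom t r b' v → z ≼ b' → Heavy (edgeInto t vC) z
      separated dv' z≼b' = vC , ≤-refl , inj₂ (Dom.≼leaf dC , λ vC≼z → lo-apart dv' v≢vC v≤vC (≼-trans vC≼z z≼b'))

    path-plan : ∀ {θa θb a b Rest} → Position θa a → θb ≤ θa → Position θb b →
      PlanFrom (λ z → AboveHeavy θb z ⊎ z ≡ b) b Rest → PlanFrom (AboveHeavy θa) a (treePath a b ++ Rest)
    path-plan {θa} {θb} {a} {b} {Rest} pa θb≤θa pb k {vis} av =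
      subst (Plan vis a) (trans (sym (++-assoc ascending descending Rest)) (cong (_++ Rest) (sym split)))
        (walk-plan capped-climb (walk climb) (commonPrefix-≼ˡ a b , ≼-refl)
          (All.map (λ (p≼z , z≺a) → p≼z , proj₁ z≺a) (inside climb))
          (All.map (λ (p≼z , z≺a) → A.above (≼-trans r≼p p≼z) z≺a) (inside climb))
          (λ av' → subst (λ s → Plan _ s (descending ++ Rest)) (sym (ends climb)) (sink-plan arrival av')) av)
      where
      module A = Position pa
      module B = Position pb
      open TreePath (tree-path {t} {a} {b} A.vertex B.vertex)
      open WalkBetween
      p = commonPrefix a b
      r≼p : r ≼ p
      r≼p = commonPrefix-greatest a b A.root≼ B.root≼
      capped-climb : Capped θa (λ z → p ≼ z × z ≼ a)
      capped-climb = record { base = p ; below = proj₁ ; edges = λ p≺u (_ , u≼a) → A.edges (≼-≺-trans r≼p p≺u) u≼a }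
      capped-sink : Capped θb (λ z → p ≼ z × z ≼ b)
      capped-sink = record { base = p ; below = proj₁ ; edges = λ p≺u (_ , u≼b) → B.edges (≼-≺-trans r≼p p≺u) u≼b }
      sink-plan : ∀ {D} → Arrival t p b D → PlanFrom (AboveHeavy θa) p (D ++ Rest)
      sink-plan (stay p≡b) av' = subst (λ s → Plan _ s Rest) (sym p≡b) (k (All.map (inj₁ ∘ AboveHeavy-mono θb≤θa) av'))
      sink-plan (enter {D₀} p≺b w₀ st inside₀) {vis'} av' =
        subst (Plan vis' p) (sym (++-assoc D₀ [ b ] Rest))
          (walk-plan capped-sink w₀ (≼-refl , proj₁ p≺b)
            (All.map (λ (p≺z , z≺b) → proj₁ p≺z , proj₁ z≺b) inside₀)
            (All.map (λ (p≺z , z≺b) → B.above (≼-trans r≼p (proj₁ p≺z)) z≺b) inside₀)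
            arrive (All.map (AboveHeavy-mono θb≤θa) av'))
        where
        arrive : PlanFrom (AboveHeavy θb) (endpoint p D₀) (b ∷ Rest)
        arrive {vis''} av'' with insert b vis''
        ... | _ , ins = step st (inj₂ (All.map (AboveHeavy-mono (B.edges (≼-≺-trans r≼p p≺b) ≼-refl)) av'')) ins
                          (k (Insert-All ins (All.map inj₁ av'') (inj₂ refl)))

    explore-plan : ∀ {θ v E Rest} → Target θ v → Explore t r L v E →
      PlanFrom (AboveHeavy θ) v Rest → PlanFrom (AboveHeavy θ) v (E ++ Rest)
    explore-plan {θ} {v} {Rest = Rest} target (w , inC , _ , returns) k =
      walk-plan capped w root-inside inC (All.map inside inC) (subst (λ s → PlanFrom (AboveHeavy θ) s Rest) (sym returns) k)
      where
      open Target target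
      capped : Capped θ (InC t r L v)
      capped = record { base = v ; below = λ ic → proj₁ (proj₂ (proj₂ ic)) ; edges = inside-edges }

    data Schedule (λ₀ : ℕ) : ℕ → List Addr → Set where
      finish : ∀ {θ} → λ₀ ≤ θ → Schedule λ₀ θ []
      visit  : ∀ {θ θ' v vs} → θ' ≤ θ → Target θ' v → Schedule λ₀ θ' vs → Schedule λ₀ θ (v ∷ vs)

    Schedule-weaken : ∀ {λ₀ θ θ' vs} → θ ≤ θ' → Schedule λ₀ θ vs → Schedule λ₀ θ' vs
    Schedule-weaken θ≤θ' (finish λ₀≤θ) = finish (≤-trans λ₀≤θ θ≤θ')
    Schedule-weaken θ≤θ' (visit le target s) = visit (≤-trans le θ≤θ') target s

    visits-plan : ∀ {λ₀ θ cur vs W end Rest} → Visits t r L cur vs W end → Schedule λ₀ θ vs → Position θ cur →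
      (∀ {θe} → λ₀ ≤ θe → Position θe end → PlanFrom (AboveHeavy θe) end Rest) →
      PlanFrom (AboveHeavy θ) cur (W ++ Rest)
    visits-plan [] (finish λ₀≤θ) pos k = k λ₀≤θ pos
    visits-plan {cur = cur} {Rest = Rest} (_∷_ {v = v} {E = E} {W = W} ex vt) (visit θ'≤θ target s) pos k {vis} av =
      subst (Plan vis cur) (sym (trans (++-assoc (treePath cur v) (E ++ W) Rest) (cong (treePath cur v ++_) (++-assoc E W Rest))))
        (path-plan pos θ'≤θ position
          (λ av' → explore-plan target ex (visits-plan vt s position k)
                     (All.map (λ { (inj₁ above) → above ; (inj₂ refl) → inside root-inside }) av'))
          av)
      where open Target target

    lo-schedule : ∀ {lo} → (∀ {v} → v ∈ lo → Target (edgeInto t vC) v) → Schedule (edgeInto t vC) (edgeInto t vC) lo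
    lo-schedule {[]} _ = finish ≤-refl
    lo-schedule {v ∷ lo} targets = visit ≤-refl (targets (here refl)) (lo-schedule (targets ∘ there))

    hi-schedule : ∀ {v hi lo} → (∀ {w} → w ∈ v ∷ hi → Target (edgeInto t w) w × edgeInto t vC < edgeInto t w) →
      Linked (λ x y → edgeInto t y ≤ edgeInto t x) (v ∷ hi) → Schedule (edgeInto t vC) (edgeInto t vC) lo →
      Schedule (edgeInto t vC) (edgeInto t v) (v ∷ hi ++ lo)
    hi-schedule targets [-] s =
      visit ≤-refl (proj₁ (targets (here refl))) (Schedule-weaken (ℕ.<⇒≤ (proj₂ (targets (here refl)))) s)
    hi-schedule targets (w≤v ∷ l) s =
      visit ≤-refl (proj₁ (targets (here refl))) (Schedule-weaken w≤v (hi-schedule (targets ∘ there) l s))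

    level-schedule : ∀ {hi lo} → OrderSpec t r L vC hi lo → Schedule (edgeInto t vC) (start-threshold hi vC) (hi ++ lo)
    level-schedule {[]} os = lo-schedule λ v∈ → let (cr , v≢vC , v≤vC) = OrderSpec.lo-root os v∈ in lo-target cr v≢vC v≤vC
    level-schedule {_ ∷ _} os = hi-schedule (λ w∈ → let (cr , vC<w) = hi-root w∈ in hi-target cr vC<w , vC<w) hi-descending
      (lo-schedule λ v∈ → let (cr , v≢vC , v≤vC) = lo-root v∈ in lo-target cr v≢vC v≤vC)
      where open OrderSpec os

    root-above-heavy : ∀ {hi lo} → OrderSpec t r L vC hi lo → AboveHeavy (start-threshold hi vC) r
    root-above-heavy {[]} _ = r , root-vertex , ≼-refl , vC , ≤-refl , inj₂ (Dom.≼leaf dC , ≺⇒⋡ (Dom.root≺ dC))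
    root-above-heavy {_ ∷ _} os with OrderSpec.hi-root os (here refl)
    ... | cr@(_ , _ , dv) , vC<v = Position.above (Target.position (hi-target cr vC<v)) ≼-refl (Dom.root≺ dv)

    inner-level : Level vC (Group t r L vC)
    inner-level = record
      { root-vertex = Position.vertex vC-position ; leaf = λ b g → leaf b (proj₁ g) ; below-root = λ b g → Dom.≼leaf (proj₂ g) }

    visits-end-vertex : ∀ {cur vs W end} → Visits t r L cur vs W end → IsVertex t cur → All (IsCRoot t r L) vs → IsVertex t end
    visits-end-vertex [] vcur _ = vcur
    visits-end-vertex (_ ∷ vt) _ (cr ∷ crs) = visits-end-vertex vt (CRoot-vertex cr) crs

    visits-end : ∀ {cur vs W end} → Visits t r L cur vs W end → IsVertex t cur → All (IsCRoot t r L) vs → end ∈ cur ∷ W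
    visits-end [] _ _ = here refl
    visits-end {cur} (_∷_ {v = v} {E = E} ex vt) vcur (cr ∷ crs) =
      ∈-∷-chain (treePath cur v) (treePath-reaches vcur (CRoot-vertex cr))
        (∈-∷-++ʳ E (visits-end vt (CRoot-vertex cr) crs))

    visits-member : ∀ {cur vs W end v x} → Visits t r L cur vs W end → IsVertex t cur → All (IsCRoot t r L) vs →
      v ∈ vs → InC t r L v x → x ∈ cur ∷ W
    visits-member {cur} (_∷_ {v = v} (_ , _ , covers , _) vt) vcur (cr ∷ _) (here refl) ic =
      ∈-∷-chain (treePath cur v) (treePath-reaches vcur (CRoot-vertex cr)) (∈-++⁺ˡ (covers _ ic))
    visits-member {cur} (_∷_ {v = v} {E = E} ex vt) vcur (cr ∷ crs) (there v∈) ic =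
      ∈-∷-chain (treePath cur v) (treePath-reaches vcur (CRoot-vertex cr))
        (∈-∷-++ʳ E (visits-member vt (CRoot-vertex cr) crs v∈ ic))

    bt-in-group : ∀ {b v} → L b → Dom t r b v → bt ≼ b → v ≡ vC
    bt-in-group {b} Lb dv bt≼b with leaf-maximal {t} {bt} bt-leaf bt≼b (IsLeaf⇒IsVertex {t} {b} (leaf b Lb))
    ... | refl = Dom-unique dv dC

    bt-⋠-other : ∀ {v} → IsCRoot t r L v → v ≢ vC → ¬ bt ≼ v
    bt-⋠-other (_ , Lb , dv) v≢vC bt≼v = v≢vC (bt-in-group Lb dv (≼-trans bt≼v (Dom.≼leaf dv)))

    visits-avoid : ∀ {cur vs W end} → Visits t r L cur vs W end → IsVertex t cur → ¬ bt ≼ cur →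
      All (λ v → IsCRoot t r L v × v ≢ vC) vs → ¬ bt ≼ end × bt ∉ W
    visits-avoid [] vcur bt⋠cur [] = bt⋠cur , λ ()
    visits-avoid {cur} (_∷_ {v = v} {E = E} (_ , inside , _) vt) vcur bt⋠cur ((cr , v≢vC) ∷ others)
      with visits-avoid vt (CRoot-vertex cr) (bt-⋠-other cr v≢vC) others
    ... | bt⋠end , bt∉W =
      bt⋠end , λ bt∈ → [ not-on-path , [ not-explored , bt∉W ]′ ∘ ∈-++⁻ E ]′ (∈-++⁻ (treePath cur v) bt∈)
      where
      not-on-path : bt ∉ treePath cur v
      not-on-path bt∈ = [ bt⋠cur ∘ proj₁ , bt-⋠-other cr v≢vC ]′ (treePath-∈ vcur (CRoot-vertex cr) bt∈)
      not-explored : bt ∉ E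
      not-explored bt∈ with All.lookup inside bt∈
      ... | _ , (Lb , dv) , _ , bt≼b = v≢vC (bt-in-group Lb dv bt≼b)

    level-ends-at-bt : ∀ {hi lo Wv end W} → OrderSpec t r L vC hi lo → Visits t r L r (hi ++ lo) Wv end →
      (vC ≡ bt × W ≡ []) ⊎ (¬ bt ≼ vC × EndsAtBt W) → EndsAtBt (Wv ++ treePath end vC ++ W)
    level-ends-at-bt {end = end} os visits inner with visits-avoid visits root-vertex bt⋠r (OrderSpec.others os)
      where bt⋠r = ≺⇒⋡ (≺-≼-trans (Dom.root≺ dC) (Dom.≼leaf dC))
    ... | bt⋠end , bt∉Wv = EndsAtBt-++ bt∉Wv (final inner)
      where
      vend = visits-end-vertex visits root-vertex (OrderSpec.roots os)
      final : _ → EndsAtBt (treePath end vC ++ _)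
      final (inj₁ (refl , refl)) with treePath-last vend vC-vertex bt⋠end
      ... | P , e , bt∉P = P , trans (++-identityʳ _) e , bt∉P
      final (inj₂ (bt⋠vC , ends)) =
        EndsAtBt-++ (λ bt∈ → [ bt⋠end ∘ proj₁ , bt⋠vC ]′ (treePath-∈ vend vC-vertex bt∈)) ends

    level-covers : ∀ {hi lo Wv end W} → OrderSpec t r L vC hi lo → Visits t r L r (hi ++ lo) Wv end →
      (∀ b → Group t r L vC b → b ∈ vC ∷ W) → ∀ b → L b → b ∈ r ∷ Wv ++ treePath end vC ++ W
    level-covers {Wv = Wv} {end} os visits inner b Lb with b ≟A r
    ... | yes refl = here refl
    ... | no b≢r with Dom-exists {t} (below-root b Lb , b≢r ∘ sym)
    ...   | v , dv with v ≟A vC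
    ...     | yes refl =
      ∈-∷-chain Wv (visits-end visits root-vertex (OrderSpec.roots os))
        (∈-∷-chain (treePath end vC)
          (treePath-reaches (visits-end-vertex visits root-vertex (OrderSpec.roots os)) vC-vertex) (inner b (Lb , dv)))
    ...     | no v≢vC =
      ∈-++⁺ˡ (visits-member visits root-vertex (OrderSpec.roots os) (OrderSpec.other-complete os (b , Lb , dv) v≢vC)
                (b , (Lb , dv) , Dom.≼leaf dv , ≼-refl))

  inner-threshold : ∀ {r L vC W} → Dom t r bt vC → (P : Proc t bt vC (Group t r L vC) W) → proc-threshold P ≤ edgeInto t vC
  inner-threshold dC finished = z≤n
  inner-threshold dC (level {vC = vC'} {hi = []} dC' _ _ _) = Dom.below≤ dC vC' (Dom.root≺ dC') (Dom.≼leaf dC')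
  inner-threshold dC (level {hi = v ∷ _} _ os _ _) with OrderSpec.hi-root os (here refl)
  ... | (_ , (_ , d) , dv) , _ = Dom.below≤ d v (Dom.root≺ dv) (Dom.≼leaf dv)

  procedure-plan : ∀ {r L W} (P : Proc t bt r L W) → Level r L → ∀ {c} → proc-threshold P ≤ c →
    PlanFrom (λ z → AboveHeavy c z ⊎ z ≡ r) r W
  procedure-plan finished _ _ _ = done
  procedure-plan (level dC os visits P) ℓ θ≤c av =
    visits-plan visits (level-schedule os) start-position
      (λ vC≤θ pos → path-plan pos vC≤θ vC-position (procedure-plan P inner-level (inner-threshold dC P)))
      (All.map (λ { (inj₁ above) → AboveHeavy-mono θ≤c above ; (inj₂ refl) → root-above-heavy os }) av)
    where open AtLevel ℓ dC

  procedure-ends-at-bt : ∀ {r L W} (P : Proc t bt r L W) → Level r L → (r ≡ bt × W ≡ []) ⊎ (¬ bt ≼ r × EndsAtBt W)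
  procedure-ends-at-bt finished _ = inj₁ (refl , refl)
  procedure-ends-at-bt (level dC os visits P) ℓ =
    inj₂ (≺⇒⋡ (≺-≼-trans (Dom.root≺ dC) (Dom.≼leaf dC)) , level-ends-at-bt os visits (procedure-ends-at-bt P inner-level))
    where open AtLevel ℓ dC

  procedure-covers : ∀ {r L W} (P : Proc t bt r L W) → Level r L → ∀ b → L b → b ∈ r ∷ W
  procedure-covers finished ℓ b Lb =
    here (leaf-maximal {t} {bt} bt-leaf (Level.below-root ℓ b Lb) (IsLeaf⇒IsVertex {t} {b} (Level.leaf ℓ b Lb)))
  procedure-covers (level dC os visits P) ℓ = level-covers os visits (procedure-covers P inner-level)
    where open AtLevel ℓ dC

  procedure-optimal : ∀ {W} → Proc t bt [] (IsLeaf t) W →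
    Σ ℕ (λ k → Solves t bt k W × ((k' : ℕ) (W' : List Addr) → Solves t bt k' W' → k ≤ k'))
  procedure-optimal {W} P =
    peak plan , plan-solves plan covers (plan-last plan ending) , λ _ _ → plan-optimal plan (nontrivial ending)
    where
    top-level : Level [] (IsLeaf t)
    top-level = record { root-vertex = root-is-vertex ; leaf = λ _ b-leaf → b-leaf ; below-root = λ _ _ → []≼ }
    plan = procedure-plan P top-level ≤-refl (inj₂ refl ∷ [])
    ending = procedure-ends-at-bt P top-level
    nontrivial : ([] ≡ bt × W ≡ []) ⊎ (¬ bt ≼ [] × EndsAtBt W) → bt ≢ [] ⊎ W ≡ []
    nontrivial (inj₁ (_ , W≡[])) = inj₂ W≡[]
    nontrivial (inj₂ (bt⋠[] , _)) = inj₁ λ bt≡[] → bt⋠[] (subst (bt ≼_) bt≡[] ≼-refl)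
    covers : ∀ v → IsVertex t v → v ∈ filled plan
    covers v vv with leaf-below vv
    ... | b , b-leaf , v≼b with procedure-covers P top-level b b-leaf | v ≟A []
    ...   | here refl | _ = filled-⊇-vis plan (here (≼-[] v≼b))
    ...   | there _ | yes refl = filled-⊇-vis plan (here refl)
    ...   | there b∈W | no v≢[] = filled-⊇-walk plan (walk-enters-ancestors (plan-walk plan) b∈W v≼b (v≢[] ∘ ≼-[]))

lemma8 : (t : Tree) (bt : Addr) → IsLeaf t bt →
         (W : List Addr) → Proc t bt [] (IsLeaf t) W →
         Σ ℕ (λ k → Solves t bt k W ×
           ((k' : ℕ) (W' : List Addr) → Solves t bt k' W' → k ≤ k'))
lemma8 t bt bt-leaf _ = Procedure.procedure-optimal t bt bt-leaf
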